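{- Let $\Gamma$ be a finite multiset of $D$-formulas and let $G$ be a $G$-formula such that $G\supset\bot,\Gamma\longrightarrow G$ has a C-proof. If $\Sigma\longrightarrow\Pi$ is a sequent appearing in this C-proof, then there is some $F\in\Pi$ such that $\Sigma\longrightarrow F$ has an I-proof.
   Context: Formulas are first-order with logical symbols $\top,\bot,\land,\lor,\supset,\exists,\forall$; $\top,\bot$ are not atomic. A sequent $\Gamma\longrightarrow\Delta$ is a pair of finite multisets of formulas. A C-proof is a derivation in the classical multiple-succedent sequent calculus whose axioms are sequents with $\top\in\Delta$ or with some $A$ ($\bot$ or atomic) in both $\Gamma$ and $\Delta$, and whose rules are: contr-L ($B,B,\Gamma\longrightarrow\Delta\Rightarrow B,\Gamma\longrightarrow\Delta$), contr-R ($\Gamma\longrightarrow\Delta,B,B\Rightarrow\Gamma\longrightarrow\Delta,B$), $\bot$-R ($\Gamma\longrightarrow\Delta,\bot\Rightarrow\Gamma\longrightarrow\Delta,D$), $\land$-L ($B,D,B\land D,\Gamma\longrightarrow\Delta\Rightarrow B\land D,\Gamma\longrightarrow\Delta$), $\land$-R ($\Gamma\longrightarrow\Delta,B$ and $\Gamma\longrightarrow\Delta,D\Rightarrow\Gamma\longrightarrow\Delta,B\land D$), $\lor$-L ($B,\Gamma\longrightarrow\Delta$ and $D,\Gamma\longrightarrow\Delta\Rightarrow B\lor D,\Gamma\longrightarrow\Delta$), $\lor$-R ($\Gamma\longrightarrow\Delta,B$ or $\Gamma\longrightarrow\Delta,D\Rightarrow\Gamma\longrightarrow\Delta,B\lor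 D$), $\supset$-L ($B\supset D,\Gamma\longrightarrow B,\Delta$ and $D,\Gamma\longrightarrow\Theta\Rightarrow B\supset D,\Gamma\longrightarrow\Delta,\Theta$), $\supset$-R ($B,\Gamma\longrightarrow\Delta,D\Rightarrow\Gamma\longrightarrow\Delta,B\supset D$), $\forall$-L ($[t/x]B,\forall xB,\Gamma\longrightarrow\Delta\Rightarrow\forall xB,\Gamma\longrightarrow\Delta$), $\exists$-R ($\Gamma\longrightarrow\Delta,[t/x]B\Rightarrow\Gamma\longrightarrow\Delta,\exists xB$), $\exists$-L ($[c/x]B,\Gamma\longrightarrow\Delta\Rightarrow\exists xB,\Gamma\longrightarrow\Delta$), $\forall$-R ($\Gamma\longrightarrow\Delta,[c/x]B\Rightarrow\Gamma\longrightarrow\Delta,\forall xB$), $c$ a constant not in the lower sequent. An I-proof is a C-proof in which every sequent has exactly one succedent formula. $G$-formulas and $D$-formulas: $G ::= \top \mid \bot \mid A \mid G\land G \mid G\lor G \mid D\supset G \mid \exists x\, G$ and $D ::= \top \mid \bot \mid A \mid G\supset D \mid D\land D \mid D\lor D \mid \exists x\, D \mid \forall x\, D$, $A$ atomic. -}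

module Defs where

open import Data.Nat using (ℕ; zero; suc)
open import Data.Fin using (Fin; zero; suc)
open import Data.List using (List; []; _∷_; _++_; [_]; length)
open import Data.List.Membership.Propositional using (_∈_)
open import Data.List.Relation.Unary.All using (All)
open import Data.List.Relation.Unary.Any using (Any)
open import Data.List.Relation.Binary.Permutation.Propositional using (_↭_)
open import Data.Product using (_×_; _,_; proj₂)
open import Data.Sum using (_⊎_)
open import Data.Empty using (⊥)
open import Relation.Nullary using (¬_)
open import Relation.Binary.PropositionalEquality using (_≡_)

-- First-order terms and formulas (de Bruijn; n = number of bound
-- variables in scope).

data Term (n : ℕ) : Set where
  var : Fin n → Term n
  fn  : ℕ → List (Term n) → Term n

const : ∀ {n} → ℕ → Term n
const c = fn c []

infixr 6 _∧_
infixr 5 _∨_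
infixr 4 _⊃_

data Formula (n : ℕ) : Set where
  top bot : Formula n
  atom    : ℕ → List (Term n) → Formula n
  _∧_ _∨_ _⊃_ : Formula n → Formula n → Formula n
  ex all  : Formula (suc n) → Formula n

mutual
  renT : ∀ {m n} → (Fin m → Fin n) → Term m → Term n
  renT ρ (var x)   = var (ρ x)
  renT ρ (fn f ts) = fn f (renTs ρ ts)

  renTs : ∀ {m n} → (Fin m → Fin n) → List (Term m) → List (Term n)
  renTs ρ []       = []
  renTs ρ (t ∷ ts) = renT ρ t ∷ renTs ρ ts

liftS : ∀ {m n} → (Fin m → Term n) → Fin (suc m) → Term (suc n)
liftS σ zero    = var zero
liftS σ (suc i) = renT suc (σ i)

mutual
  subT : ∀ {m n} → (Fin m → Term n) → Term m → Term n
  subT σ (var x)   = σ x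
  subT σ (fn f ts) = fn f (subTs σ ts)

  subTs : ∀ {m n} → (Fin m → Term n) → List (Term m) → List (Term n)
  subTs σ []       = []
  subTs σ (t ∷ ts) = subT σ t ∷ subTs σ ts

subF : ∀ {m n} → (Fin m → Term n) → Formula m → Formula n
subF σ top        = top
subF σ bot        = bot
subF σ (atom p ts) = atom p (subTs σ ts)
subF σ (A ∧ B)    = subF σ A ∧ subF σ B
subF σ (A ∨ B)    = subF σ A ∨ subF σ B
subF σ (A ⊃ B)    = subF σ A ⊃ subF σ B
subF σ (ex A)     = ex (subF (liftS σ) A)
subF σ (all A)    = all (subF (liftS σ) A)

-- [t/x]B = inst B t : instantiate the outermost bound variable of B by closed t
inst : Formula 1 → Term 0 → Formula 0
inst B t = subF (λ { zero → t ; (suc ()) }) B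

mutual
  OccT : ∀ {n} → ℕ → Term n → Set
  OccT c (var x)   = ⊥
  OccT c (fn f ts) = (c ≡ f) ⊎ OccTs c ts

  OccTs : ∀ {n} → ℕ → List (Term n) → Set
  OccTs c []       = ⊥
  OccTs c (t ∷ ts) = OccT c t ⊎ OccTs c ts

OccF : ∀ {n} → ℕ → Formula n → Set
OccF c top         = ⊥
OccF c bot         = ⊥
OccF c (atom p ts) = OccTs c ts
OccF c (A ∧ B)     = OccF c A ⊎ OccF c B
OccF c (A ∨ B)     = OccF c A ⊎ OccF c B
OccF c (A ⊃ B)     = OccF c A ⊎ OccF c B
OccF c (ex A)      = OccF c A
OccF c (all A)     = OccF c A

Fresh : ℕ → List (Formula 0) → List (Formula 0) → Set
Fresh c Γ Δ = ¬ Any (OccF c) Γ × ¬ Any (OccF c) Δ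

data BotOrAtom : Formula 0 → Set where
  isBot  : BotOrAtom bot
  isAtom : ∀ p ts → BotOrAtom (atom p ts)

mutual
  data IsG {n : ℕ} : Formula n → Set where
    gTop  : IsG top
    gBot  : IsG bot
    gAtom : ∀ p ts → IsG (atom p ts)
    gAnd  : ∀ {A B} → IsG A → IsG B → IsG (A ∧ B)
    gOr   : ∀ {A B} → IsG A → IsG B → IsG (A ∨ B)
    gImp  : ∀ {A B} → IsD A → IsG B → IsG (A ⊃ B)
    gEx   : ∀ {A} → IsG A → IsG (ex A)

  data IsD {n : ℕ} : Formula n → Set where
    dTop  : IsD top
    dBot  : IsD bot
    dAtom : ∀ p ts → IsD (atom p ts)
    dImp  : ∀ {A B} → IsG A → IsD B → IsD (A ⊃ B)
    dAnd  : ∀ {A B} → IsD A → IsD B → IsD (A ∧ B)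
    dOr   : ∀ {A B} → IsD A → IsD B → IsD (A ∨ B)
    dEx   : ∀ {A} → IsD A → IsD (ex A)
    dAll  : ∀ {A} → IsD A → IsD (all A)

-- C-proofs.  A sequent Γ ⟶ Δ is a pair of lists of closed formulas
-- regarded as multisets: each rule may be applied to any lower sequent
-- that is a permutation of the displayed one.

Cx : Set
Cx = List (Formula 0)

data CProof : Cx → Cx → Set where
  axTop  : ∀ {Γ Δ} → top ∈ Δ → CProof Γ Δ
  axAtom : ∀ {Γ Δ A} → BotOrAtom A → A ∈ Γ → A ∈ Δ → CProof Γ Δ
  contrL : ∀ {Γ Δ Γ' B} → Γ ↭ B ∷ Γ' →
           CProof (B ∷ B ∷ Γ') Δ → CProof Γ Δ
  contrR : ∀ {Γ Δ Δ' B} → Δ ↭ B ∷ Δ' →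
           CProof Γ (B ∷ B ∷ Δ') → CProof Γ Δ
  botR   : ∀ {Γ Δ Δ' D} → Δ ↭ D ∷ Δ' →
           CProof Γ (bot ∷ Δ') → CProof Γ Δ
  andL   : ∀ {Γ Δ Γ' B D} → Γ ↭ (B ∧ D) ∷ Γ' →
           CProof (B ∷ D ∷ (B ∧ D) ∷ Γ') Δ → CProof Γ Δ
  andR   : ∀ {Γ Δ Δ' B D} → Δ ↭ (B ∧ D) ∷ Δ' →
           CProof Γ (B ∷ Δ') → CProof Γ (D ∷ Δ') → CProof Γ Δ
  orL    : ∀ {Γ Δ Γ' B D} → Γ ↭ (B ∨ D) ∷ Γ' →
           CProof (B ∷ Γ') Δ → CProof (D ∷ Γ') Δ → CProof Γ Δ
  orR₁   : ∀ {Γ Δ Δ' B D} → Δ ↭ (B ∨ D) ∷ Δ' →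
           CProof Γ (B ∷ Δ') → CProof Γ Δ
  orR₂   : ∀ {Γ Δ Δ' B D} → Δ ↭ (B ∨ D) ∷ Δ' →
           CProof Γ (D ∷ Δ') → CProof Γ Δ
  impL   : ∀ {Γ Δ Γ' Δ₁ Θ B D} → Γ ↭ (B ⊃ D) ∷ Γ' → Δ ↭ Δ₁ ++ Θ →
           CProof ((B ⊃ D) ∷ Γ') (B ∷ Δ₁) → CProof (D ∷ Γ') Θ →
           CProof Γ Δ
  impR   : ∀ {Γ Δ Δ' B D} → Δ ↭ (B ⊃ D) ∷ Δ' →
           CProof (B ∷ Γ) (D ∷ Δ') → CProof Γ Δ
  allL   : ∀ {Γ Δ Γ' B} → Γ ↭ all B ∷ Γ' → (t : Term 0) →
           CProof (inst B t ∷ all B ∷ Γ') Δ → CProof Γ Δ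
  exR    : ∀ {Γ Δ Δ' B} → Δ ↭ ex B ∷ Δ' → (t : Term 0) →
           CProof Γ (inst B t ∷ Δ') → CProof Γ Δ
  exL    : ∀ {Γ Δ Γ' B} → Γ ↭ ex B ∷ Γ' → (c : ℕ) → Fresh c Γ Δ →
           CProof (inst B (const c) ∷ Γ') Δ → CProof Γ Δ
  allR   : ∀ {Γ Δ Δ' B} → Δ ↭ all B ∷ Δ' → (c : ℕ) → Fresh c Γ Δ →
           CProof Γ (inst B (const c) ∷ Δ') → CProof Γ Δ

Sequent : Set
Sequent = Cx × Cx

sequents : ∀ {Γ Δ} → CProof Γ Δ → List Sequent
sequents {Γ} {Δ} (axTop _)        = [ (Γ , Δ) ]
sequents {Γ} {Δ} (axAtom _ _ _)   = [ (Γ , Δ) ]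
sequents {Γ} {Δ} (contrL _ d)     = (Γ , Δ) ∷ sequents d
sequents {Γ} {Δ} (contrR _ d)     = (Γ , Δ) ∷ sequents d
sequents {Γ} {Δ} (botR _ d)       = (Γ , Δ) ∷ sequents d
sequents {Γ} {Δ} (andL _ d)       = (Γ , Δ) ∷ sequents d
sequents {Γ} {Δ} (andR _ d e)     = (Γ , Δ) ∷ sequents d ++ sequents e
sequents {Γ} {Δ} (orL _ d e)      = (Γ , Δ) ∷ sequents d ++ sequents e
sequents {Γ} {Δ} (orR₁ _ d)       = (Γ , Δ) ∷ sequents d
sequents {Γ} {Δ} (orR₂ _ d)       = (Γ , Δ) ∷ sequents d
sequents {Γ} {Δ} (impL _ _ d e)   = (Γ , Δ) ∷ sequents d ++ sequents e
sequents {Γ} {Δ} (impR _ d)       = (Γ , Δ) ∷ sequents d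
sequents {Γ} {Δ} (allL _ _ d)     = (Γ , Δ) ∷ sequents d
sequents {Γ} {Δ} (exR _ _ d)      = (Γ , Δ) ∷ sequents d
sequents {Γ} {Δ} (exL _ _ _ d)    = (Γ , Δ) ∷ sequents d
sequents {Γ} {Δ} (allR _ _ _ d)   = (Γ , Δ) ∷ sequents d

IsIProof : ∀ {Γ Δ} → CProof Γ Δ → Set
IsIProof d = All (λ s → length (proj₂ s) ≡ 1) (sequents d)

{-# OPTIONS --safe #-}
-- A C-proof of Γ ⟶ Δ, with Γ of D-formulas and Δ of G-formulas, is read in
-- continuation-passing style: in any context Σ ⊇ Γ in which every formula of Δ is refuted
-- (an I-proof of it in a larger context yields ⊥), ⊥ has an I-proof.  Only D-formulas are
-- ever decomposed on the left and only G-formulas on the right, so ∀-R never occurs, and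
-- ⊃-R, whose premise keeps the other succedent formulas, is handled by applying the
-- refutation of B ⊃ D once more as soon as D is reached.  At the end sequent G ⊃ ⊥ refutes
-- G, so G ⊃ ⊥, Γ ⊢ ⊥.  Going up the C-proof an antecedent only grows, or trades a
-- disjunction, implication or existential for a disjunct, consequent or instance, and ⊥
-- stays derivable; ⊥-R then gives Σ ⟶ F for any F of the never empty succedent Π.
module Submission where

open import Defs
open import Data.Nat using (ℕ; suc; _≟_; _⊔_; _≤_)
open import Data.Nat.Properties using (m≤m⊔n; m≤n⊔m; ≤-trans; 1+n≰n)
open import Data.Fin using (Fin; zero; suc)
open import Data.List using (List; []; _∷_; [_]; _++_)
open import Data.List.Membership.Propositional using (_∈_)
open import Data.List.Membership.Propositional.Properties using (∈-∃++; ∈-++⁺ʳ)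
open import Data.List.Relation.Unary.Any using (Any; here; there)
open import Data.List.Relation.Unary.All as All using (All; []; _∷_)
open import Data.List.Relation.Unary.All.Properties using (¬Any⇒All¬; ++⁺; ++⁻)
open import Data.List.Relation.Binary.Subset.Propositional using (_⊆_)
open import Data.List.Relation.Binary.Subset.Propositional.Properties
  using (⊆-refl; ⊆-reflexive-↭; ⊆-respʳ-↭; ∷⁺ʳ; ∈-∷⁺ʳ; Any-resp-⊆)
open import Data.List.Relation.Binary.Permutation.Propositional using (_↭_; ↭-refl; ↭-sym)
open import Data.List.Relation.Binary.Permutation.Propositional.Properties using (All-resp-↭; shift)
open import Data.Product using (Σ-syntax; ∃-syntax; _×_; _,_; proj₁; proj₂; map; zip)
open import Data.Sum using (inj₁; inj₂)
open import Data.Empty using (⊥-elim)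
open import Function using (_∘_; id)
open import Relation.Nullary using (¬_; yes; no)
open import Relation.Binary.PropositionalEquality using (_≡_; refl; sym; trans; cong; cong₂; subst)

mutual
  IsG-subF : ∀ {m n} (σ : Fin m → Term n) {A} → IsG A → IsG (subF σ A)
  IsG-subF σ gTop         = gTop
  IsG-subF σ gBot         = gBot
  IsG-subF σ (gAtom p ts) = gAtom p _
  IsG-subF σ (gAnd a b)   = gAnd (IsG-subF σ a) (IsG-subF σ b)
  IsG-subF σ (gOr a b)    = gOr (IsG-subF σ a) (IsG-subF σ b)
  IsG-subF σ (gImp a b)   = gImp (IsD-subF σ a) (IsG-subF σ b)
  IsG-subF σ (gEx a)      = gEx (IsG-subF (liftS σ) a)

  IsD-subF : ∀ {m n} (σ : Fin m → Term n) {A} → IsD A → IsD (subF σ A)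
  IsD-subF σ dTop         = dTop
  IsD-subF σ dBot         = dBot
  IsD-subF σ (dAtom p ts) = dAtom p _
  IsD-subF σ (dImp a b)   = dImp (IsG-subF σ a) (IsD-subF σ b)
  IsD-subF σ (dAnd a b)   = dAnd (IsD-subF σ a) (IsD-subF σ b)
  IsD-subF σ (dOr a b)    = dOr (IsD-subF σ a) (IsD-subF σ b)
  IsD-subF σ (dEx a)      = dEx (IsD-subF (liftS σ) a)
  IsD-subF σ (dAll a)     = dAll (IsD-subF (liftS σ) a)

mutual
  relabelT : ∀ {n} → (ℕ → ℕ) → Term n → Term n
  relabelT ρ (var x)   = var x
  relabelT ρ (fn f ts) = fn (ρ f) (relabelTs ρ ts)

  relabelTs : ∀ {n} → (ℕ → ℕ) → List (Term n) → List (Term n)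
  relabelTs ρ []       = []
  relabelTs ρ (t ∷ ts) = relabelT ρ t ∷ relabelTs ρ ts

relabel : ∀ {n} → (ℕ → ℕ) → Formula n → Formula n
relabel ρ top         = top
relabel ρ bot         = bot
relabel ρ (atom p ts) = atom p (relabelTs ρ ts)
relabel ρ (A ∧ B)     = relabel ρ A ∧ relabel ρ B
relabel ρ (A ∨ B)     = relabel ρ A ∨ relabel ρ B
relabel ρ (A ⊃ B)     = relabel ρ A ⊃ relabel ρ B
relabel ρ (ex A)      = ex (relabel ρ A)
relabel ρ (all A)     = all (relabel ρ A)

mutual
  relabelT-renT : ∀ {m n} ρ (π : Fin m → Fin n) (t : Term m) →
                  relabelT ρ (renT π t) ≡ renT π (relabelT ρ t)
  relabelT-renT ρ π (var x)   = refl
  relabelT-renT ρ π (fn f ts) = cong (fn (ρ f)) (relabelTs-renTs ρ π ts)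

  relabelTs-renTs : ∀ {m n} ρ (π : Fin m → Fin n) (ts : List (Term m)) →
                    relabelTs ρ (renTs π ts) ≡ renTs π (relabelTs ρ ts)
  relabelTs-renTs ρ π []       = refl
  relabelTs-renTs ρ π (t ∷ ts) = cong₂ _∷_ (relabelT-renT ρ π t) (relabelTs-renTs ρ π ts)

module _ {m n} (ρ : ℕ → ℕ) {σ : Fin m → Term n} {τ : Fin m → Term n}
         (σ≗τ : ∀ i → relabelT ρ (σ i) ≡ τ i) where

  mutual
    relabelT-subT : (t : Term m) → relabelT ρ (subT σ t) ≡ subT τ (relabelT ρ t)
    relabelT-subT (var x)   = σ≗τ x
    relabelT-subT (fn f ts) = cong (fn (ρ f)) (relabelTs-subTs ts)

    relabelTs-subTs : (ts : List (Term m)) → relabelTs ρ (subTs σ ts) ≡ subTs τ (relabelTs ρ ts)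
    relabelTs-subTs []       = refl
    relabelTs-subTs (t ∷ ts) = cong₂ _∷_ (relabelT-subT t) (relabelTs-subTs ts)

relabelT-liftS : ∀ {m n} ρ {σ τ : Fin m → Term n} → (∀ i → relabelT ρ (σ i) ≡ τ i) →
                 ∀ i → relabelT ρ (liftS σ i) ≡ liftS τ i
relabelT-liftS ρ     σ≗τ zero    = refl
relabelT-liftS ρ {σ} σ≗τ (suc i) = trans (relabelT-renT ρ suc (σ i)) (cong (renT suc) (σ≗τ i))

relabel-subF : ∀ {m n} ρ {σ τ : Fin m → Term n} → (∀ i → relabelT ρ (σ i) ≡ τ i) →
               (A : Formula m) → relabel ρ (subF σ A) ≡ subF τ (relabel ρ A)
relabel-subF ρ σ≗τ top         = refl
relabel-subF ρ σ≗τ bot         = refl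
relabel-subF ρ σ≗τ (atom p ts) = cong (atom p) (relabelTs-subTs ρ σ≗τ ts)
relabel-subF ρ σ≗τ (A ∧ B)     = cong₂ _∧_ (relabel-subF ρ σ≗τ A) (relabel-subF ρ σ≗τ B)
relabel-subF ρ σ≗τ (A ∨ B)     = cong₂ _∨_ (relabel-subF ρ σ≗τ A) (relabel-subF ρ σ≗τ B)
relabel-subF ρ σ≗τ (A ⊃ B)     = cong₂ _⊃_ (relabel-subF ρ σ≗τ A) (relabel-subF ρ σ≗τ B)
relabel-subF ρ σ≗τ (ex A)      = cong ex (relabel-subF ρ (relabelT-liftS ρ σ≗τ) A)
relabel-subF ρ σ≗τ (all A)     = cong all (relabel-subF ρ (relabelT-liftS ρ σ≗τ) A)

relabel-inst : ∀ ρ (B : Formula 1) (t : Term 0) →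
               relabel ρ (inst B t) ≡ inst (relabel ρ B) (relabelT ρ t)
relabel-inst ρ B t = relabel-subF ρ (at-zero refl) B
  where
  at-zero : ∀ {σ τ : Fin 1 → Term 0} → relabelT ρ (σ zero) ≡ τ zero → ∀ i → relabelT ρ (σ i) ≡ τ i
  at-zero eq zero = eq
  at-zero eq (suc ())

mutual
  relabelT-cong : ∀ {n} {ρ ρ′ : ℕ → ℕ} (t : Term n) →
                  (∀ s → OccT s t → ρ s ≡ ρ′ s) → relabelT ρ t ≡ relabelT ρ′ t
  relabelT-cong (var x)   eq = refl
  relabelT-cong (fn f ts) eq = cong₂ fn (eq f (inj₁ refl)) (relabelTs-cong ts (λ s → eq s ∘ inj₂))

  relabelTs-cong : ∀ {n} {ρ ρ′ : ℕ → ℕ} (ts : List (Term n)) →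
                   (∀ s → OccTs s ts → ρ s ≡ ρ′ s) → relabelTs ρ ts ≡ relabelTs ρ′ ts
  relabelTs-cong []       eq = refl
  relabelTs-cong (t ∷ ts) eq =
    cong₂ _∷_ (relabelT-cong t (λ s → eq s ∘ inj₁)) (relabelTs-cong ts (λ s → eq s ∘ inj₂))

relabel-cong : ∀ {n} {ρ ρ′ : ℕ → ℕ} (A : Formula n) →
               (∀ s → OccF s A → ρ s ≡ ρ′ s) → relabel ρ A ≡ relabel ρ′ A
relabel-cong top         eq = refl
relabel-cong bot         eq = refl
relabel-cong (atom p ts) eq = cong (atom p) (relabelTs-cong ts eq)
relabel-cong (A ∧ B)     eq =
  cong₂ _∧_ (relabel-cong A (λ s → eq s ∘ inj₁)) (relabel-cong B (λ s → eq s ∘ inj₂))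
relabel-cong (A ∨ B)     eq =
  cong₂ _∨_ (relabel-cong A (λ s → eq s ∘ inj₁)) (relabel-cong B (λ s → eq s ∘ inj₂))
relabel-cong (A ⊃ B)     eq =
  cong₂ _⊃_ (relabel-cong A (λ s → eq s ∘ inj₁)) (relabel-cong B (λ s → eq s ∘ inj₂))
relabel-cong (ex A)      eq = cong ex (relabel-cong A eq)
relabel-cong (all A)     eq = cong all (relabel-cong A eq)

mutual
  relabelT-id : ∀ {n} (t : Term n) → relabelT id t ≡ t
  relabelT-id (var x)   = refl
  relabelT-id (fn f ts) = cong (fn f) (relabelTs-id ts)

  relabelTs-id : ∀ {n} (ts : List (Term n)) → relabelTs id ts ≡ ts
  relabelTs-id []       = refl
  relabelTs-id (t ∷ ts) = cong₂ _∷_ (relabelT-id t) (relabelTs-id ts)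

relabel-id : ∀ {n} (A : Formula n) → relabel id A ≡ A
relabel-id top         = refl
relabel-id bot         = refl
relabel-id (atom p ts) = cong (atom p) (relabelTs-id ts)
relabel-id (A ∧ B)     = cong₂ _∧_ (relabel-id A) (relabel-id B)
relabel-id (A ∨ B)     = cong₂ _∨_ (relabel-id A) (relabel-id B)
relabel-id (A ⊃ B)     = cong₂ _⊃_ (relabel-id A) (relabel-id B)
relabel-id (ex A)      = cong ex (relabel-id A)
relabel-id (all A)     = cong all (relabel-id A)

relabel-BotOrAtom : ∀ ρ {A} → BotOrAtom A → BotOrAtom (relabel ρ A)
relabel-BotOrAtom ρ isBot         = isBot
relabel-BotOrAtom ρ (isAtom p ts) = isAtom p _

_[_↦_] : (ℕ → ℕ) → ℕ → ℕ → ℕ → ℕ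
(ρ [ c ↦ c′ ]) s with s ≟ c
... | yes _ = c′
... | no  _ = ρ s

[↦]-same : ∀ ρ c c′ → (ρ [ c ↦ c′ ]) c ≡ c′
[↦]-same ρ c c′ with c ≟ c
... | yes _  = refl
... | no c≢c = ⊥-elim (c≢c refl)

[↦]-other : ∀ ρ {c} c′ s → ¬ s ≡ c → (ρ [ c ↦ c′ ]) s ≡ ρ s
[↦]-other ρ {c} c′ s s≢c with s ≟ c
... | yes s≡c = ⊥-elim (s≢c s≡c)
... | no  _   = refl

relabel-[↦] : ∀ {n} ρ c c′ {A : Formula n} → ¬ OccF c A → relabel (ρ [ c ↦ c′ ]) A ≡ relabel ρ A
relabel-[↦] ρ c c′ {A} c∉A =
  relabel-cong A (λ s s∈A → [↦]-other ρ c′ s (λ { refl → c∉A s∈A }))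

relabel-[↦]-inst : ∀ ρ {c} c′ {B} → ¬ OccF c B →
                   relabel (ρ [ c ↦ c′ ]) (inst B (const c)) ≡ inst (relabel ρ B) (const c′)
relabel-[↦]-inst ρ {c} c′ {B} c∉B =
  trans (relabel-inst _ B (const c))
        (cong₂ inst (relabel-[↦] ρ c c′ c∉B) (cong const ([↦]-same ρ c c′)))

mutual
  maxSymT : ∀ {n} → Term n → ℕ
  maxSymT (var x)   = 0
  maxSymT (fn f ts) = f ⊔ maxSymTs ts

  maxSymTs : ∀ {n} → List (Term n) → ℕ
  maxSymTs []       = 0
  maxSymTs (t ∷ ts) = maxSymT t ⊔ maxSymTs ts

maxSym : ∀ {n} → Formula n → ℕ
maxSym top         = 0
maxSym bot         = 0
maxSym (atom p ts) = maxSymTs ts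
maxSym (A ∧ B)     = maxSym A ⊔ maxSym B
maxSym (A ∨ B)     = maxSym A ⊔ maxSym B
maxSym (A ⊃ B)     = maxSym A ⊔ maxSym B
maxSym (ex A)      = maxSym A
maxSym (all A)     = maxSym A

maxSymCx : Cx → ℕ
maxSymCx []      = 0
maxSymCx (A ∷ Γ) = maxSym A ⊔ maxSymCx Γ

≤-⊔ˡ : ∀ {c m} n → c ≤ m → c ≤ m ⊔ n
≤-⊔ˡ n c≤m = ≤-trans c≤m (m≤m⊔n _ n)

≤-⊔ʳ : ∀ {c n} m → c ≤ n → c ≤ m ⊔ n
≤-⊔ʳ m c≤n = ≤-trans c≤n (m≤n⊔m m _)

mutual
  OccT⇒≤maxSymT : ∀ {n c} (t : Term n) → OccT c t → c ≤ maxSymT t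
  OccT⇒≤maxSymT (fn f ts) (inj₁ refl) = m≤m⊔n f _
  OccT⇒≤maxSymT (fn f ts) (inj₂ o)    = ≤-⊔ʳ f (OccTs⇒≤maxSymTs ts o)

  OccTs⇒≤maxSymTs : ∀ {n c} (ts : List (Term n)) → OccTs c ts → c ≤ maxSymTs ts
  OccTs⇒≤maxSymTs (t ∷ ts) (inj₁ o) = ≤-⊔ˡ _ (OccT⇒≤maxSymT t o)
  OccTs⇒≤maxSymTs (t ∷ ts) (inj₂ o) = ≤-⊔ʳ (maxSymT t) (OccTs⇒≤maxSymTs ts o)

OccF⇒≤maxSym : ∀ {n c} (A : Formula n) → OccF c A → c ≤ maxSym A
OccF⇒≤maxSym (atom p ts) o        = OccTs⇒≤maxSymTs ts o
OccF⇒≤maxSym (A ∧ B)     (inj₁ o) = ≤-⊔ˡ _ (OccF⇒≤maxSym A o)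
OccF⇒≤maxSym (A ∧ B)     (inj₂ o) = ≤-⊔ʳ (maxSym A) (OccF⇒≤maxSym B o)
OccF⇒≤maxSym (A ∨ B)     (inj₁ o) = ≤-⊔ˡ _ (OccF⇒≤maxSym A o)
OccF⇒≤maxSym (A ∨ B)     (inj₂ o) = ≤-⊔ʳ (maxSym A) (OccF⇒≤maxSym B o)
OccF⇒≤maxSym (A ⊃ B)     (inj₁ o) = ≤-⊔ˡ _ (OccF⇒≤maxSym A o)
OccF⇒≤maxSym (A ⊃ B)     (inj₂ o) = ≤-⊔ʳ (maxSym A) (OccF⇒≤maxSym B o)
OccF⇒≤maxSym (ex A)      o        = OccF⇒≤maxSym A o
OccF⇒≤maxSym (all A)     o        = OccF⇒≤maxSym A o

Occ⇒≤maxSymCx : ∀ {c} (Γ : Cx) → Any (OccF c) Γ → c ≤ maxSymCx Γ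
Occ⇒≤maxSymCx (A ∷ Γ) (here o)  = ≤-⊔ˡ _ (OccF⇒≤maxSym A o)
Occ⇒≤maxSymCx (A ∷ Γ) (there o) = ≤-⊔ʳ (maxSym A) (Occ⇒≤maxSymCx Γ o)

freshSym : Cx → Cx → ℕ
freshSym Γ Δ = suc (maxSymCx Γ ⊔ maxSymCx Δ)

freshSym-fresh : ∀ Γ Δ → Fresh (freshSym Γ Δ) Γ Δ
freshSym-fresh Γ Δ =
  (λ o → 1+n≰n (≤-⊔ˡ _ (Occ⇒≤maxSymCx Γ o))) , (λ o → 1+n≰n (≤-⊔ʳ _ (Occ⇒≤maxSymCx Δ o)))

∈⇒↭∷ : ∀ {A : Formula 0} {Γ} → A ∈ Γ → ∃[ Γ′ ] Γ ↭ A ∷ Γ′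
∈⇒↭∷ m with ys , zs , refl ← ∈-∃++ m = ys ++ zs , shift _ ys zs

↭∷⇒∈ : ∀ {Δ Δ′ : Cx} {A} → Δ ↭ A ∷ Δ′ → A ∈ Δ
↭∷⇒∈ p = ⊆-reflexive-↭ (↭-sym p) (here refl)

↭∷⇒⊆∷∷ : ∀ {Γ Γ′ : Cx} {A Y} → Γ ↭ A ∷ Γ′ → Γ ⊆ A ∷ Y ∷ Γ′
↭∷⇒⊆∷∷ p = ∷⁺ʳ _ there ∘ ⊆-reflexive-↭ p

∷⁺ʳ-behind : ∀ {Γ Δ : Cx} {A Y} → Γ ⊆ A ∷ Δ → Y ∷ Γ ⊆ A ∷ Y ∷ Δ
∷⁺ʳ-behind s (here refl) = there (here refl)
∷⁺ʳ-behind s (there m) with s m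
... | here refl = here refl
... | there m′  = there (there m′)

infix 3 _⊢_

-- Contexts are used through membership only: no rule consumes its principal formula and
-- ∃-L ranges over every constant, so no freshness condition arises.  ⊢⇒IProof restores
-- the C-proof form by contraction and a fresh constant.
data _⊢_ (Γ : Cx) : Formula 0 → Set where
  ax   : ∀ {A} → BotOrAtom A → A ∈ Γ → Γ ⊢ A
  topR : Γ ⊢ top
  botR : ∀ {X} → Γ ⊢ bot → Γ ⊢ X
  andL : ∀ {X B D} → (B ∧ D) ∈ Γ → B ∷ D ∷ Γ ⊢ X → Γ ⊢ X
  andR : ∀ {B D} → Γ ⊢ B → Γ ⊢ D → Γ ⊢ B ∧ D
  orL  : ∀ {X B D} → (B ∨ D) ∈ Γ → B ∷ Γ ⊢ X → D ∷ Γ ⊢ X → Γ ⊢ X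
  orR₁ : ∀ {B D} → Γ ⊢ B → Γ ⊢ B ∨ D
  orR₂ : ∀ {B D} → Γ ⊢ D → Γ ⊢ B ∨ D
  impL : ∀ {X B D} → (B ⊃ D) ∈ Γ → Γ ⊢ B → D ∷ Γ ⊢ X → Γ ⊢ X
  impR : ∀ {B D} → B ∷ Γ ⊢ D → Γ ⊢ B ⊃ D
  allL : ∀ {X B} → all B ∈ Γ → (t : Term 0) → inst B t ∷ Γ ⊢ X → Γ ⊢ X
  exR  : ∀ {B} (t : Term 0) → Γ ⊢ inst B t → Γ ⊢ ex B
  exL  : ∀ {X B} → ex B ∈ Γ → (∀ c → inst B (const c) ∷ Γ ⊢ X) → Γ ⊢ X

weaken : ∀ {Γ Δ X} → Γ ⊢ X → Γ ⊆ Δ → Δ ⊢ X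
weaken (ax b m)     s = ax b (s m)
weaken topR         s = topR
weaken (botR p)     s = botR (weaken p s)
weaken (andL m p)   s = andL (s m) (weaken p (∷⁺ʳ _ (∷⁺ʳ _ s)))
weaken (andR p q)   s = andR (weaken p s) (weaken q s)
weaken (orL m p q)  s = orL (s m) (weaken p (∷⁺ʳ _ s)) (weaken q (∷⁺ʳ _ s))
weaken (orR₁ p)     s = orR₁ (weaken p s)
weaken (orR₂ p)     s = orR₂ (weaken p s)
weaken (impL m p q) s = impL (s m) (weaken p s) (weaken q (∷⁺ʳ _ s))
weaken (impR p)     s = impR (weaken p (∷⁺ʳ _ s))
weaken (allL m t p) s = allL (s m) t (weaken p (∷⁺ʳ _ s))
weaken (exR t p)    s = exR t (weaken p s)
weaken (exL m p)    s = exL (s m) (λ c → weaken (p c) (∷⁺ʳ _ s))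

-- A formula can be dropped from a context holding one of its left-rule premises:
-- each left rule on it is replaced by the corresponding branch.
data Droppable (Γ : Cx) : Formula 0 → Set where
  disj₁   : ∀ {B D} → B ∈ Γ → Droppable Γ (B ∨ D)
  disj₂   : ∀ {B D} → D ∈ Γ → Droppable Γ (B ∨ D)
  cons    : ∀ {B D} → D ∈ Γ → Droppable Γ (B ⊃ D)
  witness : ∀ {B} c → inst B (const c) ∈ Γ → Droppable Γ (ex B)

Droppable-mono : ∀ {Γ Δ A} → Γ ⊆ Δ → Droppable Γ A → Droppable Δ A
Droppable-mono s (disj₁ m)     = disj₁ (s m)
Droppable-mono s (disj₂ m)     = disj₂ (s m)
Droppable-mono s (cons m)      = cons (s m)
Droppable-mono s (witness c m) = witness c (s m)

drop : ∀ {Γ Δ A X} → Γ ⊢ X → Γ ⊆ A ∷ Δ → Droppable Δ A → Δ ⊢ X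
drop (ax b m) s r with s m
drop (ax isBot m) s () | here refl
drop (ax (isAtom p ts) m) s () | here refl
... | there m′ = ax b m′
drop topR s r = topR
drop (botR p) s r = botR (drop p s r)
drop (andL m p) s r with s m
drop (andL m p) s () | here refl
... | there m′ = andL m′ (drop p (∷⁺ʳ-behind (∷⁺ʳ-behind s)) (Droppable-mono (there ∘ there) r))
drop (andR p q) s r = andR (drop p s r) (drop q s r)
drop (orL m p q) s r with s m
drop (orL m p q) s (disj₁ b) | here refl = drop p (∈-∷⁺ʳ (there b) s) (disj₁ b)
drop (orL m p q) s (disj₂ d) | here refl = drop q (∈-∷⁺ʳ (there d) s) (disj₂ d)
... | there m′ = orL m′ (drop p (∷⁺ʳ-behind s) (Droppable-mono there r))
                        (drop q (∷⁺ʳ-behind s) (Droppable-mono there r))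
drop (orR₁ p) s r = orR₁ (drop p s r)
drop (orR₂ p) s r = orR₂ (drop p s r)
drop (impL m p q) s r with s m
drop (impL m p q) s (cons d) | here refl = drop q (∈-∷⁺ʳ (there d) s) (cons d)
... | there m′ = impL m′ (drop p s r) (drop q (∷⁺ʳ-behind s) (Droppable-mono there r))
drop (impR p) s r = impR (drop p (∷⁺ʳ-behind s) (Droppable-mono there r))
drop (allL m t p) s r with s m
drop (allL m t p) s () | here refl
... | there m′ = allL m′ t (drop p (∷⁺ʳ-behind s) (Droppable-mono there r))
drop (exR t p) s r = exR t (drop p s r)
drop (exL m p) s r with s m
drop (exL m p) s (witness c i) | here refl = drop (p c) (∈-∷⁺ʳ (there i) s) (witness c i)
... | there m′ = exL m′ (λ c → drop (p c) (∷⁺ʳ-behind s) (Droppable-mono there r))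

IProof : Cx → Formula 0 → Set
IProof Γ X = Σ[ e ∈ CProof Γ [ X ] ] IsIProof e

⊢⇒IProof : ∀ {Γ Δ X} → Γ ⊢ X → Γ ⊆ Δ → IProof Δ X
⊢⇒IProof (ax b m) s = axAtom b (s m) (here refl) , refl ∷ []
⊢⇒IProof topR     s = axTop (here refl) , refl ∷ []
⊢⇒IProof (botR p) s = map (botR ↭-refl) (refl ∷_) (⊢⇒IProof p s)
⊢⇒IProof (andL m p) s with _ , π ← ∈⇒↭∷ (s m) =
  map (andL π) (refl ∷_) (⊢⇒IProof p (∷⁺ʳ _ (∷⁺ʳ _ (⊆-respʳ-↭ π s))))
⊢⇒IProof (andR p q) s = zip (andR ↭-refl) (λ i j → refl ∷ ++⁺ i j) (⊢⇒IProof p s) (⊢⇒IProof q s)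
⊢⇒IProof (orL m p q) s with _ , π ← ∈⇒↭∷ (s m) =
  zip (λ e₁ e₂ → contrL π (orL ↭-refl e₁ e₂)) (λ i j → refl ∷ refl ∷ ++⁺ i j)
      (⊢⇒IProof p (∷⁺ʳ _ (⊆-respʳ-↭ π s))) (⊢⇒IProof q (∷⁺ʳ _ (⊆-respʳ-↭ π s)))
⊢⇒IProof (orR₁ p) s = map (orR₁ ↭-refl) (refl ∷_) (⊢⇒IProof p s)
⊢⇒IProof (orR₂ p) s = map (orR₂ ↭-refl) (refl ∷_) (⊢⇒IProof p s)
⊢⇒IProof (impL m p q) s with _ , π ← ∈⇒↭∷ (s m) =
  zip (λ e₁ e₂ → contrL π (impL ↭-refl ↭-refl e₁ e₂)) (λ i j → refl ∷ refl ∷ ++⁺ i j)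
      (⊢⇒IProof p (there ∘ ⊆-respʳ-↭ π s)) (⊢⇒IProof q (∷⁺ʳ _ (⊆-respʳ-↭ π s)))
⊢⇒IProof (impR p) s = map (impR ↭-refl) (refl ∷_) (⊢⇒IProof p (∷⁺ʳ _ s))
⊢⇒IProof (allL m t p) s with _ , π ← ∈⇒↭∷ (s m) =
  map (allL π t) (refl ∷_) (⊢⇒IProof p (∷⁺ʳ _ (⊆-respʳ-↭ π s)))
⊢⇒IProof (exR t p) s = map (exR ↭-refl t) (refl ∷_) (⊢⇒IProof p s)
⊢⇒IProof {Δ = Δ} {X} (exL {B = B} m p) s with Δ′ , π ← ∈⇒↭∷ (s m) =
  map (contrL π ∘ exL ↭-refl c c-fresh) (λ i → refl ∷ refl ∷ i)
      (⊢⇒IProof (p c) (∷⁺ʳ _ (⊆-respʳ-↭ π s)))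
  where
  c : ℕ
  c = freshSym Δ [ X ]
  c-fresh : Fresh c (ex B ∷ ex B ∷ Δ′) [ X ]
  c-fresh with Δ-fresh , X-fresh ← freshSym-fresh Δ [ X ] =
    Δ-fresh ∘ Any-resp-⊆ (∈-∷⁺ʳ (s m) (⊆-reflexive-↭ (↭-sym π))) , X-fresh

Refuted : Cx → Formula 0 → Set
Refuted Σ A = ∀ {Σ′} → Σ ⊆ Σ′ → Σ′ ⊢ A → Σ′ ⊢ bot

Refuted-mono : ∀ {Σ Σ′ A} → Σ ⊆ Σ′ → Refuted Σ A → Refuted Σ′ A
Refuted-mono s r s′ = r (s′ ∘ s)

Relabelled : (ℕ → ℕ) → Cx → Cx → Set
Relabelled ρ Γ Σ = All (λ A → relabel ρ A ∈ Σ) Γ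

Refutes : (ℕ → ℕ) → Cx → Cx → Set
Refutes ρ Σ Δ = All (Refuted Σ ∘ relabel ρ) Δ

Relabelled-∷ : ∀ {ρ Γ Σ} A → Relabelled ρ Γ Σ → Relabelled ρ (A ∷ Γ) (relabel ρ A ∷ Σ)
Relabelled-∷ A sub = here refl ∷ All.map there sub

Refutes-mono : ∀ {ρ Σ Σ′ Δ} → Σ ⊆ Σ′ → Refutes ρ Σ Δ → Refutes ρ Σ′ Δ
Refutes-mono s = All.map (Refuted-mono s)

Relabelled-[↦] : ∀ {ρ c c′ Γ Σ} → All (¬_ ∘ OccF c) Γ → Relabelled ρ Γ Σ →
                 Relabelled (ρ [ c ↦ c′ ]) Γ Σ
Relabelled-[↦] {ρ} {c} {c′} c∉Γ sub =
  All.zipWith (λ (c∉A , m) → subst (_∈ _) (sym (relabel-[↦] ρ c c′ c∉A)) m) (c∉Γ , sub)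

Refutes-[↦] : ∀ {ρ c c′ Σ Δ} → All (¬_ ∘ OccF c) Δ → Refutes ρ Σ Δ → Refutes (ρ [ c ↦ c′ ]) Σ Δ
Refutes-[↦] {ρ} {c} {c′} {Σ} c∉Δ ref = All.zipWith refuted (c∉Δ , ref)
  where
  refuted : ∀ {F} → ¬ OccF c F × Refuted Σ (relabel ρ F) → Refuted Σ (relabel (ρ [ c ↦ c′ ]) F)
  refuted (c∉F , r) s q = r s (subst (_ ⊢_) (relabel-[↦] ρ c c′ c∉F) q)

-- ρ renames the eigenconstants of the C-proof, so that its ∃-L is simulated at every constant.
refute : ∀ {Γ Δ} → CProof Γ Δ → All IsD Γ → All IsG Δ → ∀ ρ {Σ} →
         Relabelled ρ Γ Σ → Refutes ρ Σ Δ → Σ ⊢ bot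
refute (axTop m) dΓ gΔ ρ sub ref = All.lookup ref m ⊆-refl topR
refute (axAtom b m₁ m₂) dΓ gΔ ρ sub ref =
  All.lookup ref m₂ ⊆-refl (ax (relabel-BotOrAtom ρ b) (All.lookup sub m₁))
refute (contrL p d) dΓ gΔ ρ sub ref with All-resp-↭ p dΓ | All-resp-↭ p sub
... | a ∷ dΓ′ | s ∷ sub′ = refute d (a ∷ a ∷ dΓ′) gΔ ρ (s ∷ s ∷ sub′) ref
refute (contrR p d) dΓ gΔ ρ sub ref with All-resp-↭ p gΔ | All-resp-↭ p ref
... | g ∷ gΔ′ | r ∷ ref′ = refute d dΓ (g ∷ g ∷ gΔ′) ρ sub (r ∷ r ∷ ref′)
refute (botR p d) dΓ gΔ ρ sub ref with All-resp-↭ p gΔ | All-resp-↭ p ref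
... | _ ∷ gΔ′ | _ ∷ ref′ = refute d dΓ (gBot ∷ gΔ′) ρ sub ((λ _ q → q) ∷ ref′)
refute (andL {B = B} {D} p d) dΓ gΔ ρ sub ref with All-resp-↭ p dΓ | All-resp-↭ p sub
... | dAnd a b ∷ dΓ′ | s ∷ sub′ =
  andL s (refute d (a ∷ b ∷ dAnd a b ∷ dΓ′) gΔ ρ
                 (Relabelled-∷ B (Relabelled-∷ D (s ∷ sub′))) (Refutes-mono (there ∘ there) ref))
refute (andR {B = B} {D} p d₁ d₂) dΓ gΔ ρ {Σ} sub ref with All-resp-↭ p gΔ | All-resp-↭ p ref
... | gAnd a b ∷ gΔ′ | r ∷ ref′ = refute d₁ dΓ (a ∷ gΔ′) ρ sub (refB ∷ ref′)
  where
  refB : Refuted Σ (relabel ρ B)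
  refB s qB = refute d₂ dΓ (b ∷ gΔ′) ρ (All.map s sub) (refD ∷ Refutes-mono s ref′)
    where
    refD : Refuted _ (relabel ρ D)
    refD s′ qD = r (s′ ∘ s) (andR (weaken qB s′) qD)
refute (orL {B = B} {D} p d₁ d₂) dΓ gΔ ρ sub ref with All-resp-↭ p dΓ | All-resp-↭ p sub
... | dOr a b ∷ dΓ′ | s ∷ sub′ =
  orL s (refute d₁ (a ∷ dΓ′) gΔ ρ (Relabelled-∷ B sub′) (Refutes-mono there ref))
        (refute d₂ (b ∷ dΓ′) gΔ ρ (Relabelled-∷ D sub′) (Refutes-mono there ref))
refute (orR₁ p d) dΓ gΔ ρ sub ref with All-resp-↭ p gΔ | All-resp-↭ p ref
... | gOr a _ ∷ gΔ′ | r ∷ ref′ = refute d dΓ (a ∷ gΔ′) ρ sub ((λ s q → r s (orR₁ q)) ∷ ref′)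
refute (orR₂ p d) dΓ gΔ ρ sub ref with All-resp-↭ p gΔ | All-resp-↭ p ref
... | gOr _ b ∷ gΔ′ | r ∷ ref′ = refute d dΓ (b ∷ gΔ′) ρ sub ((λ s q → r s (orR₂ q)) ∷ ref′)
refute (impL {Δ₁ = Δ₁} {B = B} {D} p q d₁ d₂) dΓ gΔ ρ {Σ} sub ref
  with All-resp-↭ p dΓ | All-resp-↭ p sub | ++⁻ Δ₁ (All-resp-↭ q gΔ) | ++⁻ Δ₁ (All-resp-↭ q ref)
... | dImp a b ∷ dΓ′ | s ∷ sub′ | gΔ₁ , gΘ | ref₁ , refΘ =
  refute d₁ (dImp a b ∷ dΓ′) (a ∷ gΔ₁) ρ (s ∷ sub′) (refB ∷ ref₁)
  where
  refB : Refuted Σ (relabel ρ B)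
  refB s′ qB = impL (s′ s) qB (refute d₂ (b ∷ dΓ′) gΘ ρ (Relabelled-∷ D (All.map s′ sub′))
                                         (Refutes-mono (there ∘ s′) refΘ))
refute (impR {B = B} {D} p d) dΓ gΔ ρ {Σ} sub ref with All-resp-↭ p gΔ | All-resp-↭ p ref
... | gImp a b ∷ gΔ′ | r ∷ ref′ =
  -- r is used twice: on B ⊃ D proved by ⊥-R, and inside, as soon as D is proved under B.
  r ⊆-refl (impR (botR (refute d (a ∷ dΓ) (b ∷ gΔ′) ρ (Relabelled-∷ B sub)
                                (refD ∷ Refutes-mono there ref′))))
  where
  refD : Refuted (relabel ρ B ∷ Σ) (relabel ρ D)
  refD s qD = r (s ∘ there) (impR (weaken qD there))
refute (allL {B = B} p t d) dΓ gΔ ρ sub ref with All-resp-↭ p dΓ | All-resp-↭ p sub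
... | dAll a ∷ dΓ′ | s ∷ sub′ =
  allL s (relabelT ρ t)
       (refute d (IsD-subF _ a ∷ dAll a ∷ dΓ′) gΔ ρ
               (here (relabel-inst ρ B t) ∷ All.map there (s ∷ sub′)) (Refutes-mono there ref))
refute (exR {B = B} p t d) dΓ gΔ ρ sub ref with All-resp-↭ p gΔ | All-resp-↭ p ref
... | gEx a ∷ gΔ′ | r ∷ ref′ =
  refute d dΓ (IsG-subF _ a ∷ gΔ′) ρ sub
         ((λ s q → r s (exR (relabelT ρ t) (subst (_ ⊢_) (relabel-inst ρ B t) q))) ∷ ref′)
refute (exL {B = B} p c (Γ-fresh , Δ-fresh) d) dΓ gΔ ρ {Σ} sub ref
  with All-resp-↭ p dΓ | All-resp-↭ p sub | All-resp-↭ p (¬Any⇒All¬ _ Γ-fresh)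
... | dEx a ∷ dΓ′ | s ∷ sub′ | c∉B ∷ c∉Γ′ = exL s λ c′ →
  refute d (IsD-subF _ a ∷ dΓ′) gΔ (ρ [ c ↦ c′ ])
         (here (relabel-[↦]-inst ρ c′ c∉B) ∷ All.map there (Relabelled-[↦] c∉Γ′ sub′))
         (Refutes-mono there (Refutes-[↦] (¬Any⇒All¬ _ Δ-fresh) ref))
refute (allR p c fr d) dΓ gΔ ρ sub ref with All-resp-↭ p gΔ
... | () ∷ _

classical⇒refutation : ∀ {Γ Δ Σ} → CProof Γ Δ → All IsD Γ → All IsG Δ →
                       Γ ⊆ Σ → All (λ F → (F ⊃ bot) ∈ Σ) Δ → Σ ⊢ bot
classical⇒refutation {Σ = Σ} d dΓ gΔ Γ⊆Σ ¬Δ =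
  refute d dΓ gΔ id (All.tabulate (λ {A} m → subst (_∈ Σ) (sym (relabel-id A)) (Γ⊆Σ m)))
                    (All.map refuted ¬Δ)
  where
  refuted : ∀ {F} → (F ⊃ bot) ∈ Σ → Refuted Σ (relabel id F)
  refuted {F} ¬F s q = impL (s ¬F) (subst (_ ⊢_) (relabel-id F) q) (ax isBot (here refl))

⊢⊥-sequents : ∀ {Γ Δ} (d : CProof Γ Δ) → Γ ⊢ bot → All (λ s → proj₁ s ⊢ bot) (sequents d)
⊢⊥-sequents (axTop _)      h = h ∷ []
⊢⊥-sequents (axAtom _ _ _) h = h ∷ []
⊢⊥-sequents (contrL p d)   h = h ∷ ⊢⊥-sequents d (weaken h (there ∘ ⊆-reflexive-↭ p))
⊢⊥-sequents (contrR _ d)   h = h ∷ ⊢⊥-sequents d h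
⊢⊥-sequents (botR _ d)     h = h ∷ ⊢⊥-sequents d h
⊢⊥-sequents (andL p d)     h = h ∷ ⊢⊥-sequents d (weaken h (there ∘ there ∘ ⊆-reflexive-↭ p))
⊢⊥-sequents (andR _ d e)   h = h ∷ ++⁺ (⊢⊥-sequents d h) (⊢⊥-sequents e h)
⊢⊥-sequents (orL p d e)    h =
  h ∷ ++⁺ (⊢⊥-sequents d (drop h (↭∷⇒⊆∷∷ p) (disj₁ (here refl))))
          (⊢⊥-sequents e (drop h (↭∷⇒⊆∷∷ p) (disj₂ (here refl))))
⊢⊥-sequents (orR₁ _ d)     h = h ∷ ⊢⊥-sequents d h
⊢⊥-sequents (orR₂ _ d)     h = h ∷ ⊢⊥-sequents d h
⊢⊥-sequents (impL p _ d e) h =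
  h ∷ ++⁺ (⊢⊥-sequents d (weaken h (⊆-reflexive-↭ p)))
          (⊢⊥-sequents e (drop h (↭∷⇒⊆∷∷ p) (cons (here refl))))
⊢⊥-sequents (impR _ d)     h = h ∷ ⊢⊥-sequents d (weaken h there)
⊢⊥-sequents (allL p _ d)   h = h ∷ ⊢⊥-sequents d (weaken h (there ∘ ⊆-reflexive-↭ p))
⊢⊥-sequents (exR _ _ d)    h = h ∷ ⊢⊥-sequents d h
⊢⊥-sequents (exL p c _ d)  h = h ∷ ⊢⊥-sequents d (drop h (↭∷⇒⊆∷∷ p) (witness c (here refl)))
⊢⊥-sequents (allR _ _ _ d) h = h ∷ ⊢⊥-sequents d h

subproofs : ∀ {Γ Δ} (d : CProof Γ Δ) → All (λ s → CProof (proj₁ s) (proj₂ s)) (sequents d)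
subproofs d@(axTop _)        = d ∷ []
subproofs d@(axAtom _ _ _)   = d ∷ []
subproofs d@(contrL _ d₁)    = d ∷ subproofs d₁
subproofs d@(contrR _ d₁)    = d ∷ subproofs d₁
subproofs d@(botR _ d₁)      = d ∷ subproofs d₁
subproofs d@(andL _ d₁)      = d ∷ subproofs d₁
subproofs d@(andR _ d₁ d₂)   = d ∷ ++⁺ (subproofs d₁) (subproofs d₂)
subproofs d@(orL _ d₁ d₂)    = d ∷ ++⁺ (subproofs d₁) (subproofs d₂)
subproofs d@(orR₁ _ d₁)      = d ∷ subproofs d₁
subproofs d@(orR₂ _ d₁)      = d ∷ subproofs d₁
subproofs d@(impL _ _ d₁ d₂) = d ∷ ++⁺ (subproofs d₁) (subproofs d₂)
subproofs d@(impR _ d₁)      = d ∷ subproofs d₁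
subproofs d@(allL _ _ d₁)    = d ∷ subproofs d₁
subproofs d@(exR _ _ d₁)     = d ∷ subproofs d₁
subproofs d@(exL _ _ _ d₁)   = d ∷ subproofs d₁
subproofs d@(allR _ _ _ d₁)  = d ∷ subproofs d₁

succedent-nonempty : ∀ {Γ Δ} → CProof Γ Δ → ∃[ F ] F ∈ Δ
succedent-nonempty (axTop m)                = _ , m
succedent-nonempty (axAtom _ _ m)           = _ , m
succedent-nonempty (contrL _ d)             = succedent-nonempty d
succedent-nonempty (contrR p _)             = _ , ↭∷⇒∈ p
succedent-nonempty (botR p _)               = _ , ↭∷⇒∈ p
succedent-nonempty (andL _ d)               = succedent-nonempty d
succedent-nonempty (andR p _ _)             = _ , ↭∷⇒∈ p
succedent-nonempty (orL _ d _)              = succedent-nonempty d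
succedent-nonempty (orR₁ p _)               = _ , ↭∷⇒∈ p
succedent-nonempty (orR₂ p _)               = _ , ↭∷⇒∈ p
succedent-nonempty (impL {Δ₁ = Δ₁} _ q _ e) =
  map id (λ F∈Θ → ⊆-reflexive-↭ (↭-sym q) (∈-++⁺ʳ Δ₁ F∈Θ)) (succedent-nonempty e)
succedent-nonempty (impR p _)               = _ , ↭∷⇒∈ p
succedent-nonempty (allL _ _ d)             = succedent-nonempty d
succedent-nonempty (exR p _ _)              = _ , ↭∷⇒∈ p
succedent-nonempty (exL _ _ _ d)            = succedent-nonempty d
succedent-nonempty (allR p _ _ _)           = _ , ↭∷⇒∈ p

lemma8 : (Γ : List (Formula 0)) (G : Formula 0) → All IsD Γ → IsG G →
    (d : CProof ((G ⊃ bot) ∷ Γ) [ G ]) →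
    ∀ (Σ' Π : List (Formula 0)) → (Σ' , Π) ∈ sequents d →
    ∃[ F ] (F ∈ Π × Σ[ e ∈ CProof Σ' [ F ] ] IsIProof e)
lemma8 Γ G dΓ gG d Σ' Π s∈d =
  let F , F∈Π = succedent-nonempty (All.lookup (subproofs d) s∈d)
      Σ'⊢⊥    = All.lookup (⊢⊥-sequents d root⊢⊥) s∈d
  in F , F∈Π , ⊢⇒IProof (botR Σ'⊢⊥) ⊆-refl
  where
  root⊢⊥ : (G ⊃ bot) ∷ Γ ⊢ bot
  root⊢⊥ = classical⇒refutation d (dImp gG dBot ∷ dΓ) (gG ∷ []) ⊆-refl (here refl ∷ [])
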